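{- Let $T$ be the complete $q$-ary tree of depth $d$ ($q\ge 2$) and let $S\subseteq V(T)$. If there exists $U\subseteq V(T)$ with $U<S$, then $\mathrm{left}(S)<S$.
   Context: The complete $q$-ary tree of depth $d$ is the rooted tree in which every vertex at distance less than $d$ from the root has exactly $q$ children, and vertices at distance $d$ are leaves. $L_i$ is the set of vertices at distance $i$ from the root. The children of a vertex $w$ are ordered $w^{(1)},\dots,w^{(q)}$; $\mathrm{children}(w)$ denotes the set of children and $\mathrm{Desc}(w)$ the set of descendants of $w$ (including $w$). The vertices of $T$ are linearly ordered (breadth-first order): the root is first; every vertex of $L_i$ precedes every vertex of $L_j$ when $i<j$; within a level, if $x$ precedes $y$ then all children of $x$ precede all children of $y$; and $w^{(1)},\dots,w^{(q)}$ appear in this order. A vertex $x$ is to the left of $y$ if they lie in the same level and $x$ precedes $y$. Two vertices $u,v$ are swappable in $S$ if $u$ is to the left of $v$ and either (1) $u\notin S$, $v\in S$, or (2) $u,v\notin S$, $\mathrm{children}(u)\cap S=\emptyset$ and $\mathrm{children}(v)\cap S\neq\emptyset$. For $u,v$ in the same level, list $\mathrm{Desc}(u)$ as $a_1,a_2,\dots$ and $\mathrm{Desc}(v)$ as $b_1,b_2,\dots$ in breadth-first order; the treeswap of $S$ between $u$ and $v$ is the set $S'$ that agrees with $S$ outside $\mathrm{Desc}(u)\cup\mathrm{Desc}(v)$ and satisfies $b_k\in S'\iff a_k\in S$ and $a_k\in S'\iff b_k\in S$. The map $\mathrm{left}$ on subsets of $V(T)$ is defined by: if $S$ has no swappable pair,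 $\mathrm{left}(S)=S$; otherwise let $i$ be the least index such that $L_i$ contains a pair swappable in $S$, let $(u,v)$ be the left-most swappable pair in $L_i$ (i.e. $u$ is the earliest vertex of $L_i$ belonging to a swappable pair as its left member and $v$ is the earliest partner of $u$), and let $\mathrm{left}(S)$ be the treeswap of $S$ between $u$ and $v$. For $A,B\subseteq V(T)$ write $A<B$ if (1) $|A\cap L_j|=|B\cap L_j|$ for every level $j$, and (2) there is a vertex $x$ with $x\in A$, $x\notin B$, such that every vertex $w$ preceding $x$ in the breadth-first order lies either in both $A$ and $B$ or in neither. -}

module Defs where

open import Data.Nat using (ℕ; zero; suc; _≤_; _<_; _<ᵇ_; _≡ᵇ_; _+_)
open import Data.Bool using (Bool; true; false; _∧_; _∨_; not; if_then_else_)
open import Data.Fin using (Fin; toℕ)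
open import Data.Vec using (Vec; []; _∷_; _∷ʳ_)
open import Data.List using (List; []; _∷_; map; concatMap; upTo)
open import Data.Bool.ListAction using (any)
open import Data.Nat.ListAction using (sum)
open import Data.List using (allFin)
open import Data.Maybe using (Maybe; just; nothing)
open import Data.Product using (Σ; _×_; _,_; ∃)
open import Relation.Binary.PropositionalEquality using (_≡_)

-- Vertices of the complete q-ary tree of depth d:
-- a vertex at level i (i ≤ d) is a path  Vec (Fin q) i  of child indices
-- (head = first step from the root); child c of p is  p ∷ʳ c
-- (the c-th child w^(c), with c : Fin q).

-- A subset of V(T): a Boolean membership predicate for each level.
-- Only the values at levels i ≤ d are ever inspected.
Subset : ℕ → Set
Subset q = (i : ℕ) → Vec (Fin q) i → Bool

-- All vertices of level i, listed in breadth-first order: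
-- children of earlier parents first, children of one parent in order 1..q.
allVecs : {q : ℕ} → (i : ℕ) → List (Vec (Fin q) i)
allVecs zero = [] ∷ []
allVecs {q} (suc i) = concatMap (λ p → map (λ c → p ∷ʳ c) (allFin q)) (allVecs i)

-- Strict breadth-first precedence within one level (lexicographic order).
lexLt : {q n : ℕ} → Vec (Fin q) n → Vec (Fin q) n → Bool
lexLt [] [] = false
lexLt (x ∷ xs) (y ∷ ys) = (toℕ x <ᵇ toℕ y) ∨ ((toℕ x ≡ᵇ toℕ y) ∧ lexLt xs ys)

hasChildIn : (d : ℕ) {q : ℕ} → Subset q → (i : ℕ) → Vec (Fin q) i → Bool
hasChildIn d {q} S i p = (i <ᵇ d) ∧ any (λ c → S (suc i) (p ∷ʳ c)) (allFin q)

swappable : (d : ℕ) {q : ℕ} → Subset q → (i : ℕ) → Vec (Fin q) i → Vec (Fin q) i → Bool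
swappable d S i u v =
  lexLt u v ∧
  ((not (S i u) ∧ S i v) ∨
   (not (S i u) ∧ not (S i v) ∧ not (hasChildIn d S i u) ∧ hasChildIn d S i v))

findMap : {A B : Set} → (A → Maybe B) → List A → Maybe B
findMap f [] = nothing
findMap f (x ∷ xs) with f x
... | just b = just b
... | nothing = findMap f xs

leftmostPair : (d : ℕ) {q : ℕ} → Subset q → (i : ℕ) → Maybe (Vec (Fin q) i × Vec (Fin q) i)
leftmostPair d S i =
  findMap (λ u → findMap (λ v → if swappable d S i u v then just (u , v) else nothing) (allVecs i))
          (allVecs i)

chosenPair : (d : ℕ) {q : ℕ} → Subset q → Maybe (Σ ℕ λ i → Vec (Fin q) i × Vec (Fin q) i)
chosenPair d S = findMap (λ i → h i (leftmostPair d S i)) (upTo (suc d))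
  where
  h : (i : ℕ) → Maybe _ → Maybe _
  h i (just uv) = just (i , uv)
  h i nothing = nothing

isPre : {q i j : ℕ} → Vec (Fin q) i → Vec (Fin q) j → Bool
isPre [] w = true
isPre (x ∷ p) [] = false
isPre (x ∷ p) (z ∷ w) = (toℕ x ≡ᵇ toℕ z) ∧ isPre p w

swapPre : {q i j : ℕ} → Vec (Fin q) i → Vec (Fin q) i → Vec (Fin q) j → Vec (Fin q) j
swapPre [] [] w = w
swapPre (x ∷ p) (y ∷ p') [] = []
swapPre (x ∷ p) (y ∷ p') (z ∷ w) = y ∷ swapPre p p' w

-- The k-th descendant of u
-- in breadth-first order is u ++ s and the k-th descendant of v is v ++ s
-- for the same suffix s, so a_k ↔ b_k is the correspondence u ++ s ↔ v ++ s.
treeswap : {q : ℕ} → Subset q → (i : ℕ) → Vec (Fin q) i → Vec (Fin q) i → Subset q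
treeswap S i u v j w =
  if isPre u w then S j (swapPre u v w)
  else if isPre v w then S j (swapPre v u w)
  else S j w

left : (d : ℕ) {q : ℕ} → Subset q → Subset q
left d S with chosenPair d S
... | nothing = S
... | just (i , u , v) = treeswap S i u v

card : {q : ℕ} → Subset q → (j : ℕ) → ℕ
card A j = sum (map (λ p → if A j p then 1 else 0) (allVecs j))

_<[_]_ : {q : ℕ} → Subset q → ℕ → Subset q → Set
_<[_]_ {q} A d B =
  ((j : ℕ) → j ≤ d → card A j ≡ card B j) ×
  (Σ ℕ λ i → Σ (Vec (Fin q) i) λ x →
     i ≤ d × A i x ≡ true × B i x ≡ false ×
     ((j : ℕ) → j < i → (w : Vec (Fin q) j) → A j w ≡ B j w) ×
     ((w : Vec (Fin q) i) → lexLt w x ≡ true → A i w ≡ B i w))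

-- Every swappable pair (u, v) of S already yields a smaller set, so neither the left-most
-- choice made by left nor q ≥ 2 matters.  The treeswap exchanges the two disjoint subtrees
-- below u and v, hence preserves every level count.  If u ∉ S ∋ v, the first vertex where the
-- result differs from S is u, which enters the set.  Otherwise u, v ∉ S, no child of u lies
-- in S, and the first difference is u^(c) for the first child v^(c) of v lying in S: it
-- enters, and the children of u before it stay outside.
-- It remains to see that S has a swappable pair.  If U < S with first difference x ∈ U ∖ S,
-- then U and S agree before x on its level but have the same count there, so S contains
-- some y to the right of x, and (x, y) is swappable.
module Submission where

open import Defs
open import Data.Bool using (Bool; true; false; _∧_; _∨_; not; if_then_else_)
open import Data.Bool.ListAction using (any)
open import Data.Bool.Properties using (T-≡; ∧-zeroʳ)
open import Data.Empty using (⊥; ⊥-elim)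
open import Data.Fin using (Fin; toℕ) renaming (zero to fzero; suc to fsuc)
open import Data.Fin.Properties using (toℕ-injective)
open import Data.List using (List; []; _∷_; map; concatMap; tabulate; allFin; applyUpTo)
open import Data.List.Membership.Propositional using (_∈_)
open import Data.List.Membership.Propositional.Properties
  using (∈-map⁺; ∈-concatMap⁺; ∈-allFin; ∈-applyUpTo⁺; ∈-applyUpTo⁻)
open import Data.List.Properties using (map-++; map-cong; map-tabulate; tabulate-cong)
open import Data.List.Relation.Unary.Any as Any using (here; there)
open import Data.Maybe using (Maybe; just; nothing)
open import Data.Nat using (ℕ; zero; suc; _+_; _≤_; _<_; _<ᵇ_; _≡ᵇ_; z≤n; s≤s; _<?_)
open import Data.Nat.ListAction using (sum)
open import Data.Nat.ListAction.Properties using (sum-++)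
open import Data.Nat.Properties
  using (≡ᵇ⇒≡; <ᵇ⇒<; <⇒<ᵇ; +-comm; +-assoc; +-identityʳ; +-cancelʳ-≡; +-mono-≤; +-mono-<-≤;
         +-mono-≤-<; ≤-refl; ≤-reflexive; <-irrefl; <-asym; <-cmp; <⇒≱; ≰⇒>; ≮⇒≥;
         m<1+n⇒m<n∨m≡n; n≮0; +-commutativeSemigroup)
open import Algebra.Properties.CommutativeSemigroup +-commutativeSemigroup
  using (interchange; xy∙z≈zy∙x)
open import Data.Product using (Σ; _×_; _,_; ∃)
open import Data.Sum using (_⊎_; inj₁; inj₂)
open import Data.Vec using (Vec; []; _∷_; _∷ʳ_; initLast)
open import Function using (Equivalence)
open import Relation.Binary.Definitions using (tri<; tri≈; tri>)
open import Relation.Binary.PropositionalEquality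
open import Relation.Nullary using (yes; no)

private
  variable
    q i j : ℕ

∧-true⁻ : ∀ {a b} → a ∧ b ≡ true → a ≡ true × b ≡ true
∧-true⁻ {true} e = refl , e

∨-true⁻ : ∀ {a b} → a ∨ b ≡ true → a ≡ true ⊎ b ≡ true
∨-true⁻ {true} _ = inj₁ refl
∨-true⁻ {false} e = inj₂ e

≡ᵇ-refl : ∀ n → (n ≡ᵇ n) ≡ true
≡ᵇ-refl zero = refl
≡ᵇ-refl (suc n) = ≡ᵇ-refl n

<ᵇ-irrefl : ∀ n → (n <ᵇ n) ≡ false
<ᵇ-irrefl zero = refl
<ᵇ-irrefl (suc n) = <ᵇ-irrefl n

<⇒<ᵇ≡true : ∀ {m n} → m < n → (m <ᵇ n) ≡ true
<⇒<ᵇ≡true m<n = Equivalence.to T-≡ (<⇒<ᵇ m<n)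

<ᵇ≡true⇒< : ∀ {m n} → (m <ᵇ n) ≡ true → m < n
<ᵇ≡true⇒< {m} {n} e = <ᵇ⇒< m n (Equivalence.from T-≡ e)

toℕ-≡ᵇ⇒≡ : {x z : Fin q} → (toℕ x ≡ᵇ toℕ z) ≡ true → x ≡ z
toℕ-≡ᵇ⇒≡ e = toℕ-injective (≡ᵇ⇒≡ _ _ (Equivalence.from T-≡ e))

≢⇒toℕ-≡ᵇ≡false : {x z : Fin q} → x ≢ z → (toℕ x ≡ᵇ toℕ z) ≡ false
≢⇒toℕ-≡ᵇ≡false {x = x} {z} x≢z with toℕ x ≡ᵇ toℕ z in e
... | true = ⊥-elim (x≢z (toℕ-≡ᵇ⇒≡ e))
... | false = refl

sum-map-+ : ∀ {A : Set} (g h : A → ℕ) xs →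
            sum (map (λ t → g t + h t) xs) ≡ sum (map g xs) + sum (map h xs)
sum-map-+ g h [] = refl
sum-map-+ g h (x ∷ xs) =
  trans (cong (g x + h x +_) (sum-map-+ g h xs)) (interchange (g x) (h x) _ _)

sum-map-concatMap : ∀ {A B : Set} (g : B → ℕ) (f : A → List B) xs →
                    sum (map g (concatMap f xs)) ≡ sum (map (λ x → sum (map g (f x))) xs)
sum-map-concatMap g f [] = refl
sum-map-concatMap g f (x ∷ xs) =
  trans (cong sum (map-++ g (f x) (concatMap f xs)))
        (trans (sum-++ (map g (f x)) _) (cong (sum (map g (f x)) +_) (sum-map-concatMap g f xs)))

sum-map-mono-≤ : ∀ {A : Set} {g h : A → ℕ} → (∀ t → g t ≤ h t) → ∀ xs →
                 sum (map g xs) ≤ sum (map h xs)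
sum-map-mono-≤ g≤h [] = z≤n
sum-map-mono-≤ g≤h (x ∷ xs) = +-mono-≤ (g≤h x) (sum-map-mono-≤ g≤h xs)

sum-map-mono-< : ∀ {A : Set} {g h : A → ℕ} → (∀ t → g t ≤ h t) →
                 ∀ {x xs} → x ∈ xs → g x < h x → sum (map g xs) < sum (map h xs)
sum-map-mono-< g≤h {xs = _ ∷ xs} (here refl) gx<hx = +-mono-<-≤ gx<hx (sum-map-mono-≤ g≤h xs)
sum-map-mono-< g≤h {xs = y ∷ _} (there x∈xs) gx<hx =
  +-mono-≤-< (g≤h y) (sum-map-mono-< g≤h x∈xs gx<hx)

sum-map-<⇒ : ∀ {A : Set} (g h : A → ℕ) xs → sum (map g xs) < sum (map h xs) → ∃ λ t → g t < h t
sum-map-<⇒ g h (x ∷ xs) lt with g x <? h x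
... | yes gx<hx = x , gx<hx
... | no gx≮hx = sum-map-<⇒ g h xs (≰⇒> λ tail≥ → <⇒≱ lt (+-mono-≤ (≮⇒≥ gx≮hx) tail≥))

∑ : ∀ {n} → (Fin n → ℕ) → ℕ
∑ f = sum (tabulate f)

∑-cong : ∀ {n} {f g : Fin n → ℕ} → (∀ z → f z ≡ g z) → ∑ f ≡ ∑ g
∑-cong f≗g = cong sum (tabulate-cong f≗g)

∑-update : ∀ {n} (x : Fin n) {f g : Fin n → ℕ} → (∀ z → x ≢ z → g z ≡ f z) →
           ∑ g + f x ≡ ∑ f + g x
∑-update fzero {f} {g} agree =
  trans (cong (λ s → g fzero + s + f fzero) (∑-cong λ z → agree (fsuc z) λ ()))
        (xy∙z≈zy∙x (g fzero) _ (f fzero))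
∑-update (fsuc x) {f} {g} agree = begin
  g fzero + ∑ (λ z → g (fsuc z)) + f (fsuc x)   ≡⟨ +-assoc (g fzero) _ _ ⟩
  g fzero + (∑ (λ z → g (fsuc z)) + f (fsuc x))
    ≡⟨ cong₂ _+_ (agree fzero λ ()) (∑-update x λ z x≢z → agree (fsuc z) λ { refl → x≢z refl }) ⟩
  f fzero + (∑ (λ z → f (fsuc z)) + g (fsuc x)) ≡⟨ +-assoc (f fzero) _ _ ⟨
  f fzero + ∑ (λ z → f (fsuc z)) + g (fsuc x)   ∎
  where open ≡-Reasoning

allVecs-complete : ∀ j (t : Vec (Fin q) j) → t ∈ allVecs j
allVecs-complete zero [] = here refl
allVecs-complete (suc j) t with initLast t
... | p , c , refl =
  ∈-concatMap⁺ _ (Any.map (λ { refl → ∈-map⁺ _ (∈-allFin c) }) (allVecs-complete j p))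

levelSum : ∀ j → (Vec (Fin q) j → ℕ) → ℕ
levelSum j g = sum (map g (allVecs j))

levelSum-cong : ∀ j {g h : Vec (Fin q) j → ℕ} → (∀ t → g t ≡ h t) → levelSum j g ≡ levelSum j h
levelSum-cong j g≗h = cong sum (map-cong g≗h (allVecs j))

levelSum-∷ʳ : ∀ j (g : Vec (Fin q) (suc j) → ℕ) →
              levelSum (suc j) g ≡ levelSum j (λ p → ∑ (λ c → g (p ∷ʳ c)))
levelSum-∷ʳ j g = trans (sum-map-concatMap g _ (allVecs j)) (levelSum-cong j λ p →
  cong sum (trans (cong (map g) (map-tabulate (λ c → c) (p ∷ʳ_))) (map-tabulate (p ∷ʳ_) g)))

levelSum-∷ : ∀ j (g : Vec (Fin q) (suc j) → ℕ) →
             levelSum (suc j) g ≡ ∑ (λ x → levelSum j (λ t → g (x ∷ t)))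
levelSum-∷ {q} zero g =
  trans (levelSum-∷ʳ zero g) (trans (+-identityʳ _) (∑-cong {q} λ x → sym (+-identityʳ _)))
levelSum-∷ {q} (suc j) g =
  trans (levelSum-∷ʳ (suc j) g) (trans (levelSum-∷ j _) (∑-cong {q} λ x → sym (levelSum-∷ʳ j _)))

isPre-refl : (u : Vec (Fin q) i) → isPre u u ≡ true
isPre-refl [] = refl
isPre-refl (x ∷ u) rewrite ≡ᵇ-refl (toℕ x) = isPre-refl u

isPre-∷ʳ : (u : Vec (Fin q) i) (c : Fin q) → isPre u (u ∷ʳ c) ≡ true
isPre-∷ʳ [] c = refl
isPre-∷ʳ (x ∷ u) c rewrite ≡ᵇ-refl (toℕ x) = isPre-∷ʳ u c

isPre-longer : (u : Vec (Fin q) i) (w : Vec (Fin q) j) → j < i → isPre u w ≡ false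
isPre-longer (x ∷ u) [] _ = refl
isPre-longer (x ∷ u) (z ∷ w) (s≤s j<i) rewrite isPre-longer u w j<i = ∧-zeroʳ (toℕ x ≡ᵇ toℕ z)

isPre-unique : (u v : Vec (Fin q) i) (w : Vec (Fin q) j) →
               isPre u w ≡ true → isPre v w ≡ true → u ≡ v
isPre-unique [] [] w _ _ = refl
isPre-unique (x ∷ u) (y ∷ v) (z ∷ w) eu ev
  with xz , uw ← ∧-true⁻ {toℕ x ≡ᵇ toℕ z} eu | yz , vw ← ∧-true⁻ {toℕ y ≡ᵇ toℕ z} ev =
  cong₂ _∷_ (trans (toℕ-≡ᵇ⇒≡ xz) (sym (toℕ-≡ᵇ⇒≡ yz))) (isPre-unique u v w uw vw)

isPre⇒≡ : (u w : Vec (Fin q) i) → isPre u w ≡ true → u ≡ w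
isPre⇒≡ u w e = isPre-unique u w w e (isPre-refl w)

isPre⇒∷ʳ : (u : Vec (Fin q) i) (w : Vec (Fin q) (suc i)) → isPre u w ≡ true → ∃ λ c → w ≡ u ∷ʳ c
isPre⇒∷ʳ [] (c ∷ []) _ = c , refl
isPre⇒∷ʳ (x ∷ u) (z ∷ w) e with xz , uw ← ∧-true⁻ {toℕ x ≡ᵇ toℕ z} e with isPre⇒∷ʳ u w uw
... | c , refl = c , cong (_∷ w) (sym (toℕ-≡ᵇ⇒≡ xz))

swapPre-self : (u v : Vec (Fin q) i) → swapPre u v u ≡ v
swapPre-self [] [] = refl
swapPre-self (x ∷ u) (y ∷ v) = cong (y ∷_) (swapPre-self u v)

swapPre-∷ʳ : (u v : Vec (Fin q) i) (c : Fin q) → swapPre u v (u ∷ʳ c) ≡ v ∷ʳ c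
swapPre-∷ʳ [] [] c = refl
swapPre-∷ʳ (x ∷ u) (y ∷ v) c = cong (y ∷_) (swapPre-∷ʳ u v c)

graft : (u v : Vec (Fin q) i) (a b : Vec (Fin q) j → ℕ) → Vec (Fin q) j → ℕ
graft u v a b t = if isPre u t then b (swapPre u v t) else a t

-- Stated for two functions so that the induction also covers prefixes with different first steps.
levelSum-exchange : (u v : Vec (Fin q) i) → ∀ j (a b : Vec (Fin q) j → ℕ) →
  levelSum j (graft u v a b) + levelSum j (graft v u b a) ≡ levelSum j a + levelSum j b
levelSum-exchange [] [] j a b = +-comm (levelSum j b) (levelSum j a)
levelSum-exchange (x ∷ u) (y ∷ v) zero a b = refl
levelSum-exchange {q} (x ∷ u) (y ∷ v) (suc j) a b = +-cancelʳ-≡ (A x + B y) _ _ (begin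
    levelSum (suc j) G + levelSum (suc j) H + (A x + B y)
      ≡⟨ cong₂ (λ m n → m + n + (A x + B y)) (levelSum-∷ j G) (levelSum-∷ j H) ⟩
    ∑ G′ + ∑ H′ + (A x + B y)     ≡⟨ interchange (∑ G′) _ _ _ ⟩
    ∑ G′ + A x + (∑ H′ + B y)     ≡⟨ cong₂ _+_ (∑-update x G′-off-x) (∑-update y H′-off-y) ⟩
    ∑ A + G′ x + (∑ B + H′ y)     ≡⟨ interchange (∑ A) _ _ _ ⟩
    ∑ A + ∑ B + (G′ x + H′ y)     ≡⟨ cong (∑ A + ∑ B +_) (trans (cong₂ _+_ G′-at-x H′-at-y)
                                       (levelSum-exchange u v j (λ t → a (x ∷ t)) (λ t → b (y ∷ t)))) ⟩
    ∑ A + ∑ B + (A x + B y)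
      ≡⟨ cong₂ (λ m n → m + n + (A x + B y)) (levelSum-∷ j a) (levelSum-∷ j b) ⟨
    levelSum (suc j) a + levelSum (suc j) b + (A x + B y) ∎)
  where
  open ≡-Reasoning
  G H : Vec (Fin q) (suc j) → ℕ
  G = graft (x ∷ u) (y ∷ v) a b
  H = graft (y ∷ v) (x ∷ u) b a
  G′ H′ A B : Fin q → ℕ
  G′ z = levelSum j (λ t → G (z ∷ t))
  H′ z = levelSum j (λ t → H (z ∷ t))
  A z = levelSum j (λ t → a (z ∷ t))
  B z = levelSum j (λ t → b (z ∷ t))
  G′-off-x : ∀ z → x ≢ z → G′ z ≡ A z
  G′-off-x z x≢z = levelSum-cong j λ t →
    cong (λ e → if e ∧ isPre u t then b (y ∷ swapPre u v t) else a (z ∷ t)) (≢⇒toℕ-≡ᵇ≡false x≢z)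
  H′-off-y : ∀ z → y ≢ z → H′ z ≡ B z
  H′-off-y z y≢z = levelSum-cong j λ t →
    cong (λ e → if e ∧ isPre v t then a (x ∷ swapPre v u t) else b (z ∷ t)) (≢⇒toℕ-≡ᵇ≡false y≢z)
  G′-at-x : G′ x ≡ levelSum j (graft u v (λ t → a (x ∷ t)) (λ t → b (y ∷ t)))
  G′-at-x = levelSum-cong j λ t →
    cong (λ e → if e ∧ isPre u t then b (y ∷ swapPre u v t) else a (x ∷ t)) (≡ᵇ-refl (toℕ x))
  H′-at-y : H′ y ≡ levelSum j (graft v u (λ t → b (y ∷ t)) (λ t → a (x ∷ t)))
  H′-at-y = levelSum-cong j λ t →
    cong (λ e → if e ∧ isPre v t then a (x ∷ swapPre v u t) else b (y ∷ t)) (≡ᵇ-refl (toℕ y))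

χ : Subset q → ∀ j → Vec (Fin q) j → ℕ
χ A j t = if A j t then 1 else 0

card-treeswap : (S : Subset q) (u v : Vec (Fin q) i) → u ≢ v → ∀ j →
                card (treeswap S i u v) j ≡ card S j
card-treeswap {i = i} S u v u≢v j = +-cancelʳ-≡ (card S j) _ _ (begin
  card (treeswap S i u v) j + card S j
    ≡⟨ sum-map-+ (χ (treeswap S i u v) j) (χ S j) (allVecs j) ⟨
  levelSum j (λ t → χ (treeswap S i u v) j t + χ S j t)
    ≡⟨ levelSum-cong j pointwise ⟩
  levelSum j (λ t → graft u v (χ S j) (χ S j) t + graft v u (χ S j) (χ S j) t)
    ≡⟨ sum-map-+ (graft u v (χ S j) (χ S j)) _ (allVecs j) ⟩
  levelSum j (graft u v (χ S j) (χ S j)) + levelSum j (graft v u (χ S j) (χ S j))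
    ≡⟨ levelSum-exchange u v j (χ S j) (χ S j) ⟩
  card S j + card S j ∎)
  where
  open ≡-Reasoning
  pointwise : ∀ t → χ (treeswap S i u v) j t + χ S j t ≡
                    graft u v (χ S j) (χ S j) t + graft v u (χ S j) (χ S j) t
  pointwise t with isPre u t in eu | isPre v t in ev
  ... | true  | true  = ⊥-elim (u≢v (isPre-unique u v t eu ev))
  ... | true  | false = refl
  ... | false | true  = +-comm (χ S j (swapPre v u t)) (χ S j t)
  ... | false | false = refl

module _ (S : Subset q) (u v : Vec (Fin q) i) where

  treeswap-inside-u : (w : Vec (Fin q) j) → isPre u w ≡ true →
                      treeswap S i u v j w ≡ S j (swapPre u v w)
  treeswap-inside-u w e rewrite e = refl

  treeswap-outside : (w : Vec (Fin q) j) → isPre u w ≡ false → isPre v w ≡ false →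
                     treeswap S i u v j w ≡ S j w
  treeswap-outside w eu ev rewrite eu | ev = refl

  treeswap-above : (w : Vec (Fin q) j) → j < i → treeswap S i u v j w ≡ S j w
  treeswap-above w j<i = treeswap-outside w (isPre-longer u w j<i) (isPre-longer v w j<i)

  treeswap-at-u : treeswap S i u v i u ≡ S i v
  treeswap-at-u = trans (treeswap-inside-u u (isPre-refl u)) (cong (S i) (swapPre-self u v))

  treeswap-level-invisible : S i u ≡ S i v → (w : Vec (Fin q) i) → treeswap S i u v i w ≡ S i w
  treeswap-level-invisible Su≡Sv w with isPre u w in eu
  ... | true rewrite isPre⇒≡ u w eu | swapPre-self w v = sym Su≡Sv
  ... | false with isPre v w in ev
  ... | true rewrite isPre⇒≡ v w ev | swapPre-self w u = Su≡Sv
  ... | false = refl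

lexLt-≡-∷ : (x : Fin q) (u v : Vec (Fin q) i) → lexLt (x ∷ u) (x ∷ v) ≡ lexLt u v
lexLt-≡-∷ x u v rewrite <ᵇ-irrefl (toℕ x) | ≡ᵇ-refl (toℕ x) = refl

lexLt-<-∷ : {x y : Fin q} {u v : Vec (Fin q) i} → toℕ x < toℕ y → lexLt (x ∷ u) (y ∷ v) ≡ true
lexLt-<-∷ {x = x} {y} {u} {v} x<y = cong (_∨ ((toℕ x ≡ᵇ toℕ y) ∧ lexLt u v)) (<⇒<ᵇ≡true x<y)

lexLt-∷⁻ : (x : Fin q) (u : Vec (Fin q) i) (y : Fin q) (v : Vec (Fin q) i) →
           lexLt (x ∷ u) (y ∷ v) ≡ true → toℕ x < toℕ y ⊎ (x ≡ y × lexLt u v ≡ true)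
lexLt-∷⁻ x u y v e with ∨-true⁻ e
... | inj₁ x<y = inj₁ (<ᵇ≡true⇒< x<y)
... | inj₂ e′ with x≡y , u<v ← ∧-true⁻ e′ = inj₂ (toℕ-≡ᵇ⇒≡ x≡y , u<v)

lexLt-irrefl : (u : Vec (Fin q) i) → lexLt u u ≡ false
lexLt-irrefl [] = refl
lexLt-irrefl (x ∷ u) = trans (lexLt-≡-∷ x u u) (lexLt-irrefl u)

lexLt⇒≢ : {u v : Vec (Fin q) i} → lexLt u v ≡ true → u ≢ v
lexLt⇒≢ {u = u} u<v refl with () ← trans (sym u<v) (lexLt-irrefl u)

lexLt-asym : (u v : Vec (Fin q) i) → lexLt u v ≡ true → lexLt v u ≡ true → ⊥
lexLt-asym [] [] () _
lexLt-asym (x ∷ u) (y ∷ v) e₁ e₂ with lexLt-∷⁻ x u y v e₁ | lexLt-∷⁻ y v x u e₂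
... | inj₁ x<y        | inj₁ y<x        = <-asym x<y y<x
... | inj₁ x<x        | inj₂ (refl , _) = <-irrefl refl x<x
... | inj₂ (refl , _) | inj₁ x<x        = <-irrefl refl x<x
... | inj₂ (refl , a) | inj₂ (_ , b)    = lexLt-asym u v a b

lexLt-total : (t x : Vec (Fin q) i) → lexLt t x ≡ false → lexLt x t ≡ false → t ≡ x
lexLt-total [] [] _ _ = refl
lexLt-total (a ∷ t) (b ∷ x) e₁ e₂ with <-cmp (toℕ a) (toℕ b)
... | tri< a<b _ _ with () ← trans (sym (lexLt-<-∷ {u = t} {x} a<b)) e₁
... | tri> _ _ b<a with () ← trans (sym (lexLt-<-∷ {u = x} {t} b<a)) e₂
... | tri≈ _ a≡b _ with refl ← toℕ-injective a≡b =
  cong (a ∷_) (lexLt-total t x (trans (sym (lexLt-≡-∷ a t x)) e₁) (trans (sym (lexLt-≡-∷ a x t)) e₂))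

lexLt-∷ʳ⁻ : (u v : Vec (Fin q) i) {x y : Fin q} → lexLt (u ∷ʳ x) (v ∷ʳ y) ≡ true →
            lexLt u v ≡ true ⊎ (u ≡ v × toℕ x < toℕ y)
lexLt-∷ʳ⁻ [] [] {x} {y} e with lexLt-∷⁻ x [] y [] e
... | inj₁ x<y = inj₂ (refl , x<y)
lexLt-∷ʳ⁻ (a ∷ u) (b ∷ v) {x} {y} e with lexLt-∷⁻ a (u ∷ʳ x) b (v ∷ʳ y) e
... | inj₁ a<b = inj₁ (lexLt-<-∷ {u = u} {v} a<b)
... | inj₂ (refl , e′) with lexLt-∷ʳ⁻ u v e′
...   | inj₁ u<v = inj₁ (trans (lexLt-≡-∷ a u v) u<v)
...   | inj₂ (refl , x<y) = inj₂ (refl , x<y)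

findMap-just⇒ : ∀ {A B : Set} {f : A → Maybe B} {b} xs →
                findMap f xs ≡ just b → ∃ λ x → x ∈ xs × f x ≡ just b
findMap-just⇒ {f = f} (x ∷ xs) e with f x in fx
... | just _ = x , here refl , trans fx e
... | nothing with y , y∈xs , fy ← findMap-just⇒ xs e = y , there y∈xs , fy

findMap-nothing⇒ : ∀ {A B : Set} {f : A → Maybe B} {x} xs →
                   findMap f xs ≡ nothing → x ∈ xs → f x ≡ nothing
findMap-nothing⇒ {f = f} (y ∷ xs) e x∈ with f y in fy
findMap-nothing⇒ (y ∷ xs) e (here refl) | nothing = fy
findMap-nothing⇒ (y ∷ xs) e (there x∈) | nothing = findMap-nothing⇒ xs e x∈

if-just⁻ : ∀ {A : Set} c {a b : A} → (if c then just a else nothing) ≡ just b → c ≡ true × a ≡ b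
if-just⁻ true refl = refl , refl

if-nothing⁻ : ∀ {A : Set} c {a : A} → (if c then just a else nothing) ≡ nothing → c ≡ false
if-nothing⁻ false _ = refl

module _ (d : ℕ) (S : Subset q) where

  leftmostPair-just : ∀ i {u v} → leftmostPair d S i ≡ just (u , v) → swappable d S i u v ≡ true
  leftmostPair-just i e
    with u′ , _ , e′ ← findMap-just⇒ (allVecs i) e
    with v′ , _ , e″ ← findMap-just⇒ (allVecs i) e′
    with sw , refl ← if-just⁻ (swappable d S i u′ v′) e″ = sw

  leftmostPair-nothing : ∀ i → leftmostPair d S i ≡ nothing → ∀ u v → swappable d S i u v ≡ false
  leftmostPair-nothing i e u v = if-nothing⁻ (swappable d S i u v)
    (findMap-nothing⇒ (allVecs i) (findMap-nothing⇒ (allVecs i) e (allVecs-complete i u))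
                      (allVecs-complete i v))

  -- Level 0 has no swappable pair, so the search in chosenPair reduces to levels 1, …, d.
  chosenPair-just : ∀ {i u v} → chosenPair d S ≡ just (i , u , v) →
                    i ≤ d × swappable d S i u v ≡ true
  chosenPair-just e with findMap-just⇒ (applyUpTo suc d) e
  ... | k , k∈ , e′ with leftmostPair d S k in lm
  ... | just _ with refl ← e′ with _ , k<d , refl ← ∈-applyUpTo⁻ suc k∈ =
    k<d , leftmostPair-just k lm

  chosenPair-nothing : chosenPair d S ≡ nothing →
                       ∀ {i} → i ≤ d → ∀ u v → swappable d S i u v ≡ false
  chosenPair-nothing e {zero} _ [] [] = refl
  chosenPair-nothing e {suc i} i<d with findMap-nothing⇒ (applyUpTo suc d) e (∈-applyUpTo⁺ suc i<d)
  ... | e′ with leftmostPair d S (suc i) in lm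
  ... | nothing = leftmostPair-nothing (suc i) lm

any-tabulate-false⁻ : ∀ {A : Set} {n} (f : A → Bool) (h : Fin n → A) →
                      any f (tabulate h) ≡ false → ∀ c → f (h c) ≡ false
any-tabulate-false⁻ f h e fzero with false ← f (h fzero) = refl
any-tabulate-false⁻ f h e (fsuc c) with false ← f (h fzero) =
  any-tabulate-false⁻ f (λ z → h (fsuc z)) e c

any-tabulate-first : ∀ {A : Set} {n} (f : A → Bool) (h : Fin n → A) → any f (tabulate h) ≡ true →
                     ∃ λ c → f (h c) ≡ true × (∀ c′ → toℕ c′ < toℕ c → f (h c′) ≡ false)
any-tabulate-first {n = suc n} f h e with f (h fzero) in e₀
... | true = fzero , e₀ , λ _ ()
... | false with c , fc , first ← any-tabulate-first f (λ z → h (fsuc z)) e =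
  fsuc c , fc , λ where fzero _ → e₀
                        (fsuc c′) (s≤s c′<c) → first c′ c′<c

module _ (d : ℕ) (S : Subset q) (i : ℕ) where

  hasChildIn-true⁻ : (v : Vec (Fin q) i) → hasChildIn d S i v ≡ true →
                     i < d × ∃ λ c → S (suc i) (v ∷ʳ c) ≡ true ×
                                     (∀ c′ → toℕ c′ < toℕ c → S (suc i) (v ∷ʳ c′) ≡ false)
  hasChildIn-true⁻ v e with i<d , some ← ∧-true⁻ {i <ᵇ d} e =
    <ᵇ≡true⇒< i<d , any-tabulate-first (λ c → S (suc i) (v ∷ʳ c)) (λ c → c) some

  hasChildIn-false⁻ : (u : Vec (Fin q) i) → i < d → hasChildIn d S i u ≡ false →
                      ∀ c → S (suc i) (u ∷ʳ c) ≡ false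
  hasChildIn-false⁻ u i<d e = any-tabulate-false⁻ (λ c → S (suc i) (u ∷ʳ c)) (λ c → c)
    (trans (cong (_∧ any (λ c → S (suc i) (u ∷ʳ c)) (allFin q)) (sym (<⇒<ᵇ≡true i<d))) e)

swappable-cases : ∀ l a b ha hb → l ∧ ((not a ∧ b) ∨ (not a ∧ not b ∧ not ha ∧ hb)) ≡ true →
                  l ≡ true × (a ≡ false × b ≡ true ⊎ a ≡ false × b ≡ false × ha ≡ false × hb ≡ true)
swappable-cases true false true _ _ _ = refl , inj₁ (refl , refl)
swappable-cases true false false false true _ = refl , inj₂ (refl , refl , refl , refl)
swappable-cases false _ _ _ _ ()
swappable-cases true true _ _ _ ()
swappable-cases true false false true _ ()
swappable-cases true false false false false ()

FirstDifference : Subset q → ℕ → Subset q → Set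
FirstDifference {q} A d B =
  Σ ℕ λ i → Σ (Vec (Fin q) i) λ x →
    i ≤ d × A i x ≡ true × B i x ≡ false ×
    ((j : ℕ) → j < i → (w : Vec (Fin q) j) → A j w ≡ B j w) ×
    ((w : Vec (Fin q) i) → lexLt w x ≡ true → A i w ≡ B i w)

module _ (d : ℕ) (S : Subset q) (i : ℕ) (u v : Vec (Fin q) i) (u<v : lexLt u v ≡ true) where

  treeswap-differs-first-at-u : i ≤ d → S i u ≡ false → S i v ≡ true →
                                FirstDifference (treeswap S i u v) d S
  treeswap-differs-first-at-u i≤d Su Sv =
    i , u , i≤d , trans (treeswap-at-u S u v) Sv , Su ,
    (λ j j<i w → treeswap-above S u v w j<i) , left-of-u
    where
    left-of-u : ∀ w → lexLt w u ≡ true → treeswap S i u v i w ≡ S i w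
    left-of-u w w<u with isPre u w in eu | isPre v w in ev
    ... | true | _ rewrite isPre⇒≡ u w eu with () ← trans (sym w<u) (lexLt-irrefl w)
    ... | false | true rewrite isPre⇒≡ v w ev = ⊥-elim (lexLt-asym u w u<v w<u)
    ... | false | false = refl

  treeswap-differs-first-at-child : S i u ≡ false → S i v ≡ false →
    hasChildIn d S i u ≡ false → hasChildIn d S i v ≡ true → FirstDifference (treeswap S i u v) d S
  treeswap-differs-first-at-child Su Sv hu hv
    with i<d , c , Svc , first ← hasChildIn-true⁻ d S i v hv =
    suc i , u ∷ʳ c , i<d , gains , childless c , above , left-of-uc
    where
    childless : ∀ c → S (suc i) (u ∷ʳ c) ≡ false
    childless = hasChildIn-false⁻ d S i u i<d hu
    gains : treeswap S i u v (suc i) (u ∷ʳ c) ≡ true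
    gains = trans (treeswap-inside-u S u v (u ∷ʳ c) (isPre-∷ʳ u c))
                  (trans (cong (S (suc i)) (swapPre-∷ʳ u v c)) Svc)
    above : ∀ j → j < suc i → (w : Vec (Fin q) j) → treeswap S i u v j w ≡ S j w
    above j j<1+i w with m<1+n⇒m<n∨m≡n j<1+i
    ... | inj₁ j<i = treeswap-above S u v w j<i
    ... | inj₂ refl = treeswap-level-invisible S u v (trans Su (sym Sv)) w
    left-of-uc : ∀ w → lexLt w (u ∷ʳ c) ≡ true → treeswap S i u v (suc i) w ≡ S (suc i) w
    left-of-uc w w<uc with isPre u w in eu | isPre v w in ev
    ... | true | _ with c′ , refl ← isPre⇒∷ʳ u w eu with lexLt-∷ʳ⁻ u u w<uc
    ...   | inj₁ u<u with () ← trans (sym u<u) (lexLt-irrefl u)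
    ...   | inj₂ (_ , c′<c) =
      trans (cong (S (suc i)) (swapPre-∷ʳ u v c′)) (trans (first c′ c′<c) (sym (childless c′)))
    left-of-uc w w<uc | false | true with c′ , refl ← isPre⇒∷ʳ v w ev with lexLt-∷ʳ⁻ v u w<uc
    ...   | inj₁ v<u = ⊥-elim (lexLt-asym u v u<v v<u)
    ...   | inj₂ (refl , _) with () ← trans (sym u<v) (lexLt-irrefl u)
    left-of-uc w w<uc | false | false = refl

treeswap-< : ∀ d (S : Subset q) i (u v : Vec (Fin q) i) → i ≤ d → swappable d S i u v ≡ true →
             treeswap S i u v <[ d ] S
treeswap-< d S i u v i≤d sw
  with u<v , cases ← swappable-cases _ (S i u) (S i v) (hasChildIn d S i u) (hasChildIn d S i v) sw =
  (λ j _ → card-treeswap S u v (lexLt⇒≢ u<v) j) , first-difference cases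
  where
  first-difference : _ → FirstDifference (treeswap S i u v) d S
  first-difference (inj₁ (Su , Sv)) = treeswap-differs-first-at-u d S i u v u<v i≤d Su Sv
  first-difference (inj₂ (Su , Sv , hu , hv)) =
    treeswap-differs-first-at-child d S i u v u<v Su Sv hu hv

<⇒swappable : ∀ {d} {U S : Subset q} → U <[ d ] S →
              Σ ℕ λ i → Σ (Vec (Fin q) i) λ x → Σ (Vec (Fin q) i) λ y →
                i ≤ d × swappable d S i x y ≡ true
<⇒swappable {q} {d} {U} {S} (same-counts , i , x , i≤d , Ux , Sx , _ , same-left)
  = let y , Uy<My = sum-map-<⇒ (χ U i) M (allVecs i) U<M
    in i , x , y , i≤d , right-member y Uy<My
  where
  -- M follows U up to x and S after it: S ≤ M with S x < M x, and U, S have equal level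
  -- counts, so U y < M y for some y, necessarily a member of S to the right of x.
  M : Vec (Fin q) i → ℕ
  M t = if lexLt x t then χ S i t else χ U i t
  S≤M : ∀ t → χ S i t ≤ M t
  S≤M t with lexLt x t in x<t
  ... | true = ≤-refl
  ... | false with lexLt t x in t<x
  ... | true = ≤-reflexive (cong (λ b → if b then 1 else 0) (sym (same-left t t<x)))
  ... | false with refl ← lexLt-total t x t<x x<t rewrite Sx = z≤n
  Sx<Mx : χ S i x < M x
  Sx<Mx rewrite lexLt-irrefl x | Ux | Sx = s≤s z≤n
  U<M : levelSum i (χ U i) < levelSum i M
  U<M = subst (_< levelSum i M) (sym (same-counts i i≤d))
              (sum-map-mono-< S≤M (allVecs-complete i x) Sx<Mx)
  right-member : ∀ y → χ U i y < M y → swappable d S i x y ≡ true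
  right-member y Uy<My with lexLt x y
  ... | false = ⊥-elim (<-irrefl refl Uy<My)
  ... | true with S i y
  ... | true rewrite Sx = refl
  ... | false = ⊥-elim (n≮0 Uy<My)

lemma2p2 : (d q : ℕ) → 2 ≤ q → (S : Subset q) →
           ∃ (λ (U : Subset q) → U <[ d ] S) → left d S <[ d ] S
lemma2p2 d q _ S (U , U<S) with chosenPair d S in chosen
... | just (i , u , v) with i≤d , sw ← chosenPair-just d S chosen = treeswap-< d S i u v i≤d sw
... | nothing with i , x , y , i≤d , sw ← <⇒swappable U<S
  with () ← trans (sym sw) (chosenPair-nothing d S chosen i≤d x y)
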